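{- If $T'$ and $T''$ are $K_r$-amenable trees (with weak partitions satisfying (A), (B), (C)), then any tree obtained from $T'$ and $T''$ by a Type-a or a Type-b construction is also a $K_r$-amenable graph, with the associated weak partition satisfying (A), (B), (C).
   Context: Let $r$ be an integer with $r\ge 2$. A graph $G$ is called $K_r$-amenable if there exists a weak partition $\{V_0,V_1,\ldots,V_r\}$ of $V(G)$ (pairwise disjoint, possibly empty, subsets whose union is $V(G)$) such that: (A) if $x\in V_0$, then $|N(x)\cap V_i|=1$ for every $i\in\{1,\ldots,r\}$; (B) $\langle V_i\rangle$ is a matching for every $i\in\{1,\ldots,r\}$; (C) $\langle V_1\cup\cdots\cup V_r\rangle$ is a matching. Let $T'$ be a tree of order $n$ with weak partition $\{V'_0,\ldots,V'_r\}$ of $V(T')$ and $T''$ a tree of order $m$ with weak partition $\{V''_0,\ldots,V''_r\}$ of $V(T'')$. Type-a construction: choose $i\in\{1,\ldots,r\}$, an edge $u'_iv'_i$ of $\langle V'_i\rangle$ and an edge $u''_iv''_i$ of $\langle V''_i\rangle$, and identify $u'_i$ with $u''_i$ (called $u_i$) and $v'_i$ with $v''_i$ (called $v_i$), giving a tree $T$ of order $n+m-2$ with weak partition $V_j=V'_j\cup V''_j$ for $j\ne i$ and $V_i=(V'_i\cup V''_i\cup\{u_i,v_i\})-\{u'_i,v'_i,u''_i,v''_i\}$. Type-b construction: take the disjoint union of $T'$ and $T''$ and add an edge $xy$ with $x\in V'_0$ and $y\in V''_0$, giving a tree $S$ of order $n+m$ with weak partition $V_i=V'_i\cup V''_i$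 for $0\le i\le r$. -}

module Defs where

open import Data.Nat using (ℕ; zero; suc; _≤_)
open import Data.Fin using (Fin; zero; suc; _≟_)
open import Data.List using (List; []; _∷_; _∷ʳ_; length)
open import Data.List.Relation.Unary.Unique.Propositional using (Unique)
open import Data.List.Relation.Unary.Linked using (Linked)
open import Data.Product using (Σ; ∃; _×_; _,_)
open import Data.Sum using (_⊎_; inj₁; inj₂)
open import Data.Empty using (⊥)
open import Relation.Nullary using (¬_; yes; no)
open import Relation.Nullary.Decidable using (False; fromWitnessFalse)
open import Relation.Binary.PropositionalEquality using (_≡_; _≢_)

data Walk {V : Set} (E : V → V → Set) : V → V → Set where
  here : ∀ {x} → Walk E x x
  step : ∀ {x y z} → E x y → Walk E y z → Walk E x z

HasCycle : {V : Set} → (V → V → Set) → Set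
HasCycle {V} E =
  Σ V λ x → Σ (List V) λ xs →
    (2 ≤ length xs) × Unique (x ∷ xs) × Linked E ((x ∷ xs) ∷ʳ x)

IsTree : (n : ℕ) → (Fin n → Fin n → Set) → Set
IsTree n E =
  (∀ x y → E x y → E y x) ×
  (∀ x → ¬ E x x) ×
  (∀ x y → Walk E x y) ×
  ¬ HasCycle E

-- K_r-amenability.  A weak partition {V₀,…,V_r} of V is a labelling
-- f : V → Fin (suc r); V_i = f⁻¹(i), label zero is V₀ and label suc j
-- is V_{j+1}.

ExactlyOneNbr : {V : Set} → (V → V → Set) → V → (V → Set) → Set
ExactlyOneNbr {V} E x P =
  Σ V λ y → E x y × P y × (∀ z → E x z → P z → z ≡ y)

CondA : {V : Set} (r : ℕ) → (V → V → Set) → (V → Fin (suc r)) → Set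
CondA r E f = ∀ x → f x ≡ zero → ∀ (i : Fin r) →
  ExactlyOneNbr E x (λ y → f y ≡ suc i)

CondB : {V : Set} (r : ℕ) → (V → V → Set) → (V → Fin (suc r)) → Set
CondB r E f = ∀ (i : Fin r) x → f x ≡ suc i →
  ExactlyOneNbr E x (λ y → f y ≡ suc i)

CondC : {V : Set} (r : ℕ) → (V → V → Set) → (V → Fin (suc r)) → Set
CondC r E f = ∀ x → f x ≢ zero →
  ExactlyOneNbr E x (λ y → f y ≢ zero)

AmenablePartition : {V : Set} (r : ℕ) → (V → V → Set) → (V → Fin (suc r)) → Set
AmenablePartition r E f = CondA r E f × CondB r E f × CondC r E f

KrAmenable : {V : Set} (r : ℕ) → (V → V → Set) → Set
KrAmenable {V} r E = Σ (V → Fin (suc r)) λ f → AmenablePartition r E f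

-- Type-a construction.  T' on Fin n, T'' on Fin m, edges u'v' of T'
-- and u''v'' of T''.  We identify u'' with u' (=: u) and v'' with v'
-- (=: v).  Vertex set: Fin n ⊎ (Fin m minus {u'', v''}).

RestA : (m : ℕ) → Fin m → Fin m → Set
RestA m u'' v'' = Σ (Fin m) λ w → False (w ≟ u'') × False (w ≟ v'')

VA : (n m : ℕ) → Fin m → Fin m → Set
VA n m u'' v'' = Fin n ⊎ RestA m u'' v''

ι'' : {n m : ℕ} (u' v' : Fin n) (u'' v'' : Fin m) → Fin m → VA n m u'' v''
ι'' u' v' u'' v'' w with w ≟ u''
... | yes _ = inj₁ u'
... | no p with w ≟ v''
...   | yes _ = inj₁ v'
...   | no q = inj₂ (w , fromWitnessFalse p , fromWitnessFalse q)

EA : {n m : ℕ} (E' : Fin n → Fin n → Set) (E'' : Fin m → Fin m → Set)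
     (u' v' : Fin n) (u'' v'' : Fin m) →
     VA n m u'' v'' → VA n m u'' v'' → Set
EA {n} {m} E' E'' u' v' u'' v'' a b =
  (Σ (Fin n) λ x → Σ (Fin n) λ y → E' x y × inj₁ x ≡ a × inj₁ y ≡ b) ⊎
  (Σ (Fin m) λ x → Σ (Fin m) λ y → E'' x y ×
     ι'' u' v' u'' v'' x ≡ a × ι'' u' v' u'' v'' y ≡ b)

fA : {r n m : ℕ} (f' : Fin n → Fin (suc r)) (f'' : Fin m → Fin (suc r))
     (u'' v'' : Fin m) → VA n m u'' v'' → Fin (suc r)
fA f' f'' u'' v'' (inj₁ x) = f' x
fA f' f'' u'' v'' (inj₂ (w , _)) = f'' w

EB : {n m : ℕ} (E' : Fin n → Fin n → Set) (E'' : Fin m → Fin m → Set)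
     (x : Fin n) (y : Fin m) → Fin n ⊎ Fin m → Fin n ⊎ Fin m → Set
EB E' E'' x y (inj₁ a) (inj₁ b) = E' a b
EB E' E'' x y (inj₂ a) (inj₂ b) = E'' a b
EB E' E'' x y (inj₁ a) (inj₂ b) = a ≡ x × b ≡ y
EB E' E'' x y (inj₂ a) (inj₁ b) = b ≡ x × a ≡ y

fB : {r n m : ℕ} (f' : Fin n → Fin (suc r)) (f'' : Fin m → Fin (suc r)) →
     Fin n ⊎ Fin m → Fin (suc r)
fB f' f'' (inj₁ a) = f' a
fB f' f'' (inj₂ b) = f'' b

-- Each of the conditions (A), (B), (C) has the same shape: every vertex
-- whose colour satisfies a predicate P has exactly one neighbour whose
-- colour satisfies a predicate Q.  The theorem thus
-- reduces to showing that each construction transfers unique-neighbour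
-- properties from T' and T'' to the glued graph, under a side condition
-- on P and Q that holds for all the instances needed by (A), (B), (C).
--
-- The transfers are proved vertex by vertex with a single principle
-- (transport-ExactlyOneNbr): a unique neighbour is carried along a map
-- whose image captures all relevant neighbours of the target vertex.
-- For Type-b the new edge xy joins two V₀-vertices, so it never creates
-- a neighbour of a colour other than 0.  For Type-a the vertices other
-- than u, v keep their neighbourhoods; at u (and symmetrically v) the
-- neighbourhoods of u' and u'' are merged, and both contribute the same
-- unique neighbour v, because v' and v'' are the unique such neighbours.

module Submission where

open import Defs
open import Data.Nat using (ℕ; suc; _≤_)
open import Data.Fin using (Fin; zero; suc; _≟_)
open import Data.Product using (_×_; Σ; _,_; proj₁; proj₂)
open import Data.Sum using (_⊎_; inj₁; inj₂)
open import Data.Sum.Properties using (inj₁-injective; inj₂-injective)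
open import Data.Bool.Properties using (T-irrelevant)
open import Data.Empty using (⊥-elim)
open import Function using (_∘_; id)
open import Relation.Nullary using (¬_; yes; no)
open import Relation.Nullary.Decidable using (toWitnessFalse)
open import Relation.Binary.PropositionalEquality
  using (_≡_; _≢_; refl; sym; trans; cong; cong₂; subst)

nbr-unique : {V : Set} {E : V → V → Set} {x y z : V} {P : V → Set} →
  ExactlyOneNbr E x P → E x y → P y → E x z → P z → y ≡ z
nbr-unique (_ , _ , _ , only) exy py exz pz = trans (only _ exy py) (sym (only _ exz pz))

transport-ExactlyOneNbr : {V W : Set} {E : V → V → Set} {F : W → W → Set}
  {P : V → Set} {Q : W → Set} {x : V} (a : W) (g : V → W) →
  (∀ y → E x y → P y → F a (g y) × Q (g y)) →
  (∀ z → F a z → Q z → Σ V λ y → E x y × P y × z ≡ g y) →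
  ExactlyOneNbr E x P → ExactlyOneNbr F a Q
transport-ExactlyOneNbr {F = F} {Q = Q} a g forth back (y , exy , py , only) =
  g y , proj₁ (forth y exy py) , proj₂ (forth y exy py) , unique
  where
  unique : ∀ z → F a z → Q z → z ≡ g y
  unique z faz qz with back z faz qz
  ... | y′ , exy′ , py′ , z≡gy′ = trans z≡gy′ (cong g (only y′ exy′ py′))

UniqueNbr : {V C : Set} → (V → V → Set) → (V → C) → (C → Set) → (C → Set) → Set
UniqueNbr E f P Q = ∀ x → P (f x) → ExactlyOneNbr E x (Q ∘ f)

-- Conditions (B) and (C) are unique-neighbour properties by definition;
-- (A) is one after reordering its quantifiers.
amenable-from-uniqueNbr : {V₁ V₂ W : Set} {r : ℕ}
  {E₁ : V₁ → V₁ → Set} {f₁ : V₁ → Fin (suc r)}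
  {E₂ : V₂ → V₂ → Set} {f₂ : V₂ → Fin (suc r)}
  {F : W → W → Set} {g : W → Fin (suc r)} →
  (Side : (Fin (suc r) → Set) → (Fin (suc r) → Set) → Set) →
  (∀ j → Side (_≡ zero) (_≡ suc j)) →
  (∀ j → Side (_≡ suc j) (_≡ suc j)) →
  Side (_≢ zero) (_≢ zero) →
  (∀ P Q → Side P Q → UniqueNbr E₁ f₁ P Q → UniqueNbr E₂ f₂ P Q → UniqueNbr F g P Q) →
  AmenablePartition r E₁ f₁ → AmenablePartition r E₂ f₂ → AmenablePartition r F g
amenable-from-uniqueNbr Side sideA sideB sideC transfer (A₁ , B₁ , C₁) (A₂ , B₂ , C₂) =
    (λ w gw j → transfer _ _ (sideA j) (λ x fx → A₁ x fx j) (λ x fx → A₂ x fx j) w gw)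
  , (λ j → transfer _ _ (sideB j) (B₁ j) (B₂ j))
  , transfer _ _ sideC C₁ C₂

-- Type-b: the new edge xy joins two vertices of colour 0, so it only
-- adds neighbours of colour 0; properties whose target predicate Q
-- excludes colour 0 therefore pass from T' and T'' to S.
module TypeB {r n m : ℕ} (E' : Fin n → Fin n → Set) (E'' : Fin m → Fin m → Set)
  (f' : Fin n → Fin (suc r)) (f'' : Fin m → Fin (suc r))
  (x : Fin n) (y : Fin m) (fx : f' x ≡ zero) (fy : f'' y ≡ zero) where

  S : Fin n ⊎ Fin m → Fin n ⊎ Fin m → Set
  S = EB E' E'' x y

  colour : Fin n ⊎ Fin m → Fin (suc r)
  colour = fB f' f''

  typeB-uniqueNbr : (P Q : Fin (suc r) → Set) → ¬ Q zero →
    UniqueNbr E' f' P Q → UniqueNbr E'' f'' P Q →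
    UniqueNbr S colour P Q
  typeB-uniqueNbr P Q ¬Q0 H' H'' (inj₁ a) pa =
    transport-ExactlyOneNbr {E = E'} {F = S} (inj₁ a) inj₁ (λ _ e q → e , q) back (H' a pa)
    where
    back : ∀ z → S (inj₁ a) z → Q (colour z) →
           Σ (Fin n) λ b → E' a b × Q (f' b) × z ≡ inj₁ b
    back (inj₁ b) e qb = b , e , qb , refl
    back (inj₂ _) (_ , refl) qy = ⊥-elim (¬Q0 (subst Q fy qy))
  typeB-uniqueNbr P Q ¬Q0 H' H'' (inj₂ a) pa =
    transport-ExactlyOneNbr {E = E''} {F = S} (inj₂ a) inj₂ (λ _ e q → e , q) back (H'' a pa)
    where
    back : ∀ z → S (inj₂ a) z → Q (colour z) →
           Σ (Fin m) λ b → E'' a b × Q (f'' b) × z ≡ inj₂ b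
    back (inj₂ b) e qb = b , e , qb , refl
    back (inj₁ _) (refl , _) qx = ⊥-elim (¬Q0 (subst Q fx qx))

  -- (A), (B), (C) all have target predicates excluding colour 0
  typeB-amenable : AmenablePartition r E' f' → AmenablePartition r E'' f'' →
    AmenablePartition r S colour
  typeB-amenable =
    amenable-from-uniqueNbr (λ _ Q → ¬ Q zero) (λ _ ()) (λ _ ()) (λ 0≢0 → 0≢0 refl)
      typeB-uniqueNbr

module Gluing {n m : ℕ} (u' v' : Fin n) (u'' v'' : Fin m) where

  ι : Fin m → VA n m u'' v''
  ι = ι'' u' v' u'' v''

  ι-u : ι u'' ≡ inj₁ u'
  ι-u with u'' ≟ u''
  ... | yes _ = refl
  ... | no u''≢u'' = ⊥-elim (u''≢u'' refl)

  ι-v : u'' ≢ v'' → ι v'' ≡ inj₁ v'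
  ι-v u''≢v'' with v'' ≟ u''
  ... | yes v''≡u'' = ⊥-elim (u''≢v'' (sym v''≡u''))
  ... | no _ with v'' ≟ v''
  ...   | yes _ = refl
  ...   | no v''≢v'' = ⊥-elim (v''≢v'' refl)

  ι-into-T' : ∀ w {x} → ι w ≡ inj₁ x → (w ≡ u'' × u' ≡ x) ⊎ (w ≡ v'' × v' ≡ x)
  ι-into-T' w eq with w ≟ u''
  ... | yes w≡u'' = inj₁ (w≡u'' , inj₁-injective eq)
  ... | no _ with w ≟ v''
  ...   | yes w≡v'' = inj₂ (w≡v'' , inj₁-injective eq)
  ...   | no _ with eq
  ...     | ()

  ι-into-rest : ∀ w t → ι w ≡ inj₂ t → w ≡ proj₁ t
  ι-into-rest w t eq with w ≟ u''
  ... | yes _ with eq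
  ...   | ()
  ι-into-rest w t eq | no _ with w ≟ v''
  ...   | yes _ with eq
  ...     | ()
  ι-into-rest w t eq | no _ | no _ = cong proj₁ (inj₂-injective eq)

  ι-off-ends : ∀ w → w ≢ u'' → w ≢ v'' → Σ (RestA m u'' v'') λ t → ι w ≡ inj₂ t
  ι-off-ends w w≢u'' w≢v'' with w ≟ u''
  ... | yes w≡u'' = ⊥-elim (w≢u'' w≡u'')
  ... | no _ with w ≟ v''
  ...   | yes w≡v'' = ⊥-elim (w≢v'' w≡v'')
  ...   | no _ = _ , refl

  -- elements of the remainder are determined by their vertex, since the
  -- inequality certificates are proof-irrelevant
  rest-≡ : (s t : RestA m u'' v'') → proj₁ s ≡ proj₁ t → s ≡ t
  rest-≡ (w , p , q) (.w , p′ , q′) refl =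
    cong₂ (λ a b → w , a , b) (T-irrelevant p p′) (T-irrelevant q q′)

  ι-rest : (t : RestA m u'' v'') → ι (proj₁ t) ≡ inj₂ t
  ι-rest t@(w , w≢u'' , w≢v'') with ι-off-ends w (toWitnessFalse w≢u'') (toWitnessFalse w≢v'')
  ... | s , ιw≡s = trans ιw≡s (cong inj₂ (rest-≡ s t (sym (ι-into-rest w s ιw≡s))))

  colour-ι : {r : ℕ} (f' : Fin n → Fin (suc r)) (f'' : Fin m → Fin (suc r)) →
    f' u' ≡ f'' u'' → f' v' ≡ f'' v'' → ∀ w → fA f' f'' u'' v'' (ι w) ≡ f'' w
  colour-ι f' f'' fu fv w with w ≟ u''
  ... | yes refl = fu
  ... | no _ with w ≟ v''
  ...   | yes refl = fv
  ...   | no _ = refl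

-- The glued edge uv has colour i on both sides, so at u the
-- unique neighbour of colour class Q is v whenever Q contains i; all
-- other vertices keep their neighbourhoods from T' or from T''.
module TypeA {r n m : ℕ} (E' : Fin n → Fin n → Set) (E'' : Fin m → Fin m → Set)
  (f' : Fin n → Fin (suc r)) (f'' : Fin m → Fin (suc r))
  (i : Fin r) (u' v' : Fin n) (u'' v'' : Fin m)
  (e-u'v' : E' u' v') (e-v'u' : E' v' u') (e-u''v'' : E'' u'' v'') (e-v''u'' : E'' v'' u'')
  (u'≢v' : u' ≢ v') (u''≢v'' : u'' ≢ v'')
  (fu' : f' u' ≡ suc i) (fv' : f' v' ≡ suc i) (fu'' : f'' u'' ≡ suc i) (fv'' : f'' v'' ≡ suc i)
  where

  open Gluing u' v' u'' v''

  T : VA n m u'' v'' → VA n m u'' v'' → Set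
  T = EA E' E'' u' v' u'' v''

  colour : VA n m u'' v'' → Fin (suc r)
  colour = fA f' f'' u'' v''

  -- u', u'' (and v', v'') both have colour i, so ι preserves colours
  colour-ι″ : ∀ w → colour (ι w) ≡ f'' w
  colour-ι″ = colour-ι f' f'' (trans fu' (sym fu'')) (trans fv' (sym fv''))

  ι-only-u : ∀ w → ι w ≡ inj₁ u' → w ≡ u''
  ι-only-u w eq with ι-into-T' w eq
  ... | inj₁ (w≡u'' , _) = w≡u''
  ... | inj₂ (_ , v'≡u') = ⊥-elim (u'≢v' (sym v'≡u'))

  ι-only-v : ∀ w → ι w ≡ inj₁ v' → w ≡ v''
  ι-only-v w eq with ι-into-T' w eq
  ... | inj₁ (_ , u'≡v') = ⊥-elim (u'≢v' u'≡v')
  ... | inj₂ (w≡v'' , _) = w≡v''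

  module _ (Q : Fin (suc r) → Set) where

    outer-T' : ∀ x → x ≢ u' → x ≢ v' →
      ExactlyOneNbr E' x (Q ∘ f') → ExactlyOneNbr T (inj₁ x) (Q ∘ colour)
    outer-T' x x≢u' x≢v' = transport-ExactlyOneNbr {E = E'} {F = T} (inj₁ x) inj₁
      (λ y e qy → inj₁ (x , y , e , refl , refl) , qy) back
      where
      back : ∀ z → T (inj₁ x) z → Q (colour z) → Σ (Fin n) λ y → E' x y × Q (f' y) × z ≡ inj₁ y
      back z (inj₁ (_ , y , e , refl , refl)) qz = y , e , qz , refl
      back z (inj₂ (w , _ , _ , ιw≡x , refl)) qz with ι-into-T' w ιw≡x
      ... | inj₁ (_ , u'≡x) = ⊥-elim (x≢u' (sym u'≡x))
      ... | inj₂ (_ , v'≡x) = ⊥-elim (x≢v' (sym v'≡x))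

    outer-T'' : ∀ t →
      ExactlyOneNbr E'' (proj₁ t) (Q ∘ f'') → ExactlyOneNbr T (inj₂ t) (Q ∘ colour)
    outer-T'' t = transport-ExactlyOneNbr {E = E''} {F = T} (inj₂ t) ι
      (λ y e qy → inj₂ (proj₁ t , y , e , ι-rest t , refl) , subst Q (sym (colour-ι″ y)) qy) back
      where
      back : ∀ z → T (inj₂ t) z → Q (colour z) → Σ (Fin m) λ y → E'' (proj₁ t) y × Q (f'' y) × z ≡ ι y
      back z (inj₁ (_ , _ , _ , () , _)) qz
      back z (inj₂ (w , y , e , ιw≡t , refl)) qz =
        y , subst (λ w′ → E'' w′ y) (ι-into-rest w t ιw≡t) e , subst Q (colour-ι″ y) qz , refl

    -- the merged vertex p (= u or v), glued from p' and p'' with the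
    -- Q-neighbours q of p' and q'' of p'' identified
    merged : ∀ {p q p'' q''} → (∀ w → ι w ≡ inj₁ p → w ≡ p'') → ι q'' ≡ inj₁ q →
      E' p q → Q (f' q) → E'' p'' q'' → Q (f'' q'') →
      ExactlyOneNbr E' p (Q ∘ f') → ExactlyOneNbr E'' p'' (Q ∘ f'') →
      ExactlyOneNbr T (inj₁ p) (Q ∘ colour)
    merged {p} {q} only-p'' ιq'' e qq e'' qq'' N' N'' =
      transport-ExactlyOneNbr {E = E'} {F = T} (inj₁ p) inj₁
        (λ y e qy → inj₁ (p , y , e , refl , refl) , qy) back N'
      where
      back : ∀ z → T (inj₁ p) z → Q (colour z) → Σ (Fin n) λ y → E' p y × Q (f' y) × z ≡ inj₁ y
      back z (inj₁ (_ , y , e , refl , refl)) qz = y , e , qz , refl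
      back z (inj₂ (w , y , e₀ , ιw≡p , refl)) qz with only-p'' w ιw≡p
      ... | refl = q , e , qq ,
        trans (cong ι (nbr-unique {E = E''} N'' e₀ (subst Q (colour-ι″ y) qz) e'' qq'')) ιq''

  typeA-uniqueNbr : (P Q : Fin (suc r) → Set) → (P (suc i) → Q (suc i)) →
    UniqueNbr E' f' P Q → UniqueNbr E'' f'' P Q → UniqueNbr T colour P Q
  typeA-uniqueNbr P Q P⇒Q H' H'' (inj₂ t) pt = outer-T'' Q t (H'' (proj₁ t) pt)
  typeA-uniqueNbr P Q P⇒Q H' H'' (inj₁ x) px with x ≟ u' | x ≟ v'
  ... | yes refl | _ =
    merged Q ι-only-u (ι-v u''≢v'') e-u'v' (subst Q (sym fv') qi) e-u''v'' (subst Q (sym fv'') qi)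
      (H' u' px) (H'' u'' (subst P (trans fu' (sym fu'')) px))
    where
    qi : Q (suc i)
    qi = P⇒Q (subst P fu' px)
  ... | no _ | yes refl =
    merged Q ι-only-v ι-u e-v'u' (subst Q (sym fu') qi) e-v''u'' (subst Q (sym fu'') qi)
      (H' v' px) (H'' v'' (subst P (trans fv' (sym fv'')) px))
    where
    qi : Q (suc i)
    qi = P⇒Q (subst P fv' px)
  ... | no x≢u' | no x≢v' = outer-T' Q x x≢u' x≢v' (H' x px)

  -- the side condition is vacuous for (A) and trivial for (B), (C)
  typeA-amenable : AmenablePartition r E' f' → AmenablePartition r E'' f'' →
    AmenablePartition r T colour
  typeA-amenable =
    amenable-from-uniqueNbr (λ P Q → P (suc i) → Q (suc i)) (λ _ ()) (λ _ → id) id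
      typeA-uniqueNbr

-- Only the facts that T' and T'' are simple graphs (symmetric and
-- irreflexive adjacency) are needed from the tree hypotheses.
mainTheorem4 : (r : ℕ) → 2 ≤ r →
    (n m : ℕ) (E' : Fin n → Fin n → Set) (E'' : Fin m → Fin m → Set)
    (f' : Fin n → Fin (suc r)) (f'' : Fin m → Fin (suc r)) →
    IsTree n E' → IsTree m E'' →
    AmenablePartition r E' f' → AmenablePartition r E'' f'' →
    -- Type-a construction
    ((i : Fin r) (u' v' : Fin n) (u'' v'' : Fin m) →
      E' u' v' → f' u' ≡ suc i → f' v' ≡ suc i →
      E'' u'' v'' → f'' u'' ≡ suc i → f'' v'' ≡ suc i →
      AmenablePartition r (EA E' E'' u' v' u'' v'') (fA f' f'' u'' v''))
    ×
    -- Type-b construction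
    ((x : Fin n) (y : Fin m) → f' x ≡ zero → f'' y ≡ zero →
      AmenablePartition r (EB E' E'' x y) (fB f' f''))
mainTheorem4 r _ n m E' E'' f' f'' (sym' , irrefl' , _) (sym'' , irrefl'' , _) amen' amen'' =
  (λ i u' v' u'' v'' e' fu' fv' e'' fu'' fv'' →
    TypeA.typeA-amenable E' E'' f' f'' i u' v' u'' v''
      e' (sym' u' v' e') e'' (sym'' u'' v'' e'')
      (λ { refl → irrefl' u' e' }) (λ { refl → irrefl'' u'' e'' })
      fu' fv' fu'' fv'' amen' amen'')
  ,
  (λ x y fx fy → TypeB.typeB-amenable E' E'' f' f'' x y fx fy amen' amen'')
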